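{- Let $p\ge 7$ be a prime. Then $$\sum_{k=1}^{p-1}\frac{H_k^2}{k^2}\equiv -\sum_{1\le i<j< k\le p-1}\frac{1}{ij^2k}\pmod{p}.$$
   Context: $H_n=\sum_{k=1}^{n}\frac1k$. Congruences modulo $p$ are taken in the ring of rational numbers with denominators not divisible by $p$. -}

module Defs where

open import Data.Nat as ℕ using (ℕ; zero; suc)
open import Data.Integer as ℤ using (ℤ; +_)
open import Data.Integer.Divisibility as ℤD
open import Data.Rational as ℚ using (ℚ; _+_; _*_; _-_; ↥_)

sumFrom1 : ℕ → (ℕ → ℚ) → ℚ
sumFrom1 zero    f = ℚ.0ℚ
sumFrom1 (suc n) f = sumFrom1 n f + f (suc n)

-- 1 / k for k ≥ 1 (recip 0 is 1/1, never used: all indices are ≥ 1)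
recip : ℕ → ℚ
recip zero    = ℚ.1ℚ
recip (suc k) = + 1 ℚ./ suc k

H : ℕ → ℚ
H n = sumFrom1 n recip

-- x ≡ y (mod p) in Z_(p): the reduced numerator of x - y is divisible by p.
-- (Then the reduced denominator is coprime to p, so x - y ∈ p Z_(p).)
_≡_[modℚ_] : ℚ → ℚ → ℕ → Set
x ≡ y [modℚ p ] = (+ p) ℤD.∣ (↥ (x - y))

lhs : ℕ → ℚ
lhs p = sumFrom1 (p ℕ.∸ 1) (λ k → H k * H k * recip k * recip k)

tripleSum : ℕ → ℚ
tripleSum p =
  sumFrom1 (p ℕ.∸ 1) λ k →
    sumFrom1 (k ℕ.∸ 1) λ j →
      sumFrom1 (j ℕ.∸ 1) λ i →
        recip i * recip j * recip j * recip k

-- Induction on n gives the exact identity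
--   Σ_{k≤n} H_k²/k² + H_n(1,2,1) = H_n · H_n(1,2) + H_n(1,3) + H_n(4),
-- so with N = p - 1 it suffices that H_N, H_N(1,3) and H_N(4) vanish modulo p.
-- All three follow from the reflection k ↦ p - k, under which 1/k turns into -1/k:
-- it gives H_N ≡ 0, then H_{N-k} ≡ H_k, and H_N(1,3) ≡ -(H_N(1,3) + H_N(4)).
-- For H_N(4), write N = 2q: the reflection maps the upper half of [1, N] onto the
-- lower half and the odd numbers onto the even ones, so H_N(4) ≡ 2 Σ_{k≤q} 1/k⁴ and
-- H_N(4) ≡ 2 Σ_{k≤q} 1/(2k)⁴, whence 16 H_N(4) ≡ H_N(4). The bound p ≥ 7 is only
-- needed to cancel 2 and 15.
module Submission where

open import Defs
open import Data.Nat using (ℕ; _≤_)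
open import Data.Nat.Primality using (Prime)
open import Data.Rational using (-_)

open import Level using (0ℓ)
open import Data.List using ([]; _∷_)
open import Data.Product using (∃-syntax; _,_)
open import Data.Sum using (_⊎_; inj₁; inj₂)
open import Data.Empty using (⊥-elim)
open import Data.Nat as ℕ using (zero; suc; _<_; _∸_; s≤s; z≤n)
import Data.Nat.Properties as ℕP
import Data.Nat.Tactic.RingSolver as ℕ-Solver
open import Data.Nat.Coprimality using (1-coprimeTo) renaming (sym to coprime-sym)
open import Data.Nat.Divisibility using (_∣_; _∤_; ∣-refl; m∣m*n; >⇒∤)
open import Data.Nat.Primality using (euclidsLemma; prime⇒nonTrivial)
open import Data.Integer as ℤ using (ℤ; +_)
import Data.Integer.Properties as ℤP
import Data.Integer.Divisibility as ℤ
import Data.Integer.Tactic.RingSolver as ℤ-Solver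
open import Data.Rational as ℚ using (ℚ; mkℚ; _+_; _*_; _-_; ↥_; 0ℚ; 1ℚ)
import Data.Rational.Properties as ℚP
import Data.Rational.Unnormalised as ℚᵘ
import Data.Rational.Unnormalised.Properties as ℚᵘP
open import Relation.Nullary.Decidable using (dec⇒maybe; from-yes)
open import Relation.Binary.Bundles using (Setoid)
open import Relation.Binary.PropositionalEquality
open import Function using (_∘_)
import Relation.Binary.Reasoning.Setoid as SetoidReasoning
open import Tactic.RingSolver using (solve-∀)
open import Tactic.RingSolver.Core.AlmostCommutativeRing
  using (AlmostCommutativeRing; fromCommutativeRing)


private
  variable
    k m n : ℕ
    u v w x x′ y y′ : ℚ

ℚ-ring : AlmostCommutativeRing 0ℓ 0ℓ
ℚ-ring = fromCommutativeRing ℚP.+-*-commutativeRing (λ x → dec⇒maybe (0ℚ ℚP.≟ x))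

*-interchange : ∀ a b c d → (a * b) * (c * d) ≡ (a * c) * (b * d)
*-interchange = solve-∀ ℚ-ring

fromℤ : ℤ → ℚ
fromℤ a = mkℚ a 0 (coprime-sym (1-coprimeTo ℤ.∣ a ∣))

fromℕ : ℕ → ℚ
fromℕ n = fromℤ (+ n)

fromℤ-+ : ∀ a b → fromℤ (a ℤ.+ b) ≡ fromℤ a + fromℤ b
fromℤ-+ a b = ℚP.toℚᵘ-injective (ℚᵘP.≃-sym (ℚᵘP.≃-trans
  (ℚP.toℚᵘ-homo-+ (fromℤ a) (fromℤ b)) (ℚᵘ.*≡* cross)))
  where
  cross : (a ℤ.* + 1 ℤ.+ b ℤ.* + 1) ℤ.* + 1 ≡ (a ℤ.+ b) ℤ.* (+ 1 ℤ.* + 1)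
  cross = ℤ-Solver.solve (a ∷ b ∷ [])

fromℤ-* : ∀ a b → fromℤ (a ℤ.* b) ≡ fromℤ a * fromℤ b
fromℤ-* a b = ℚP.toℚᵘ-injective (ℚᵘP.≃-sym (ℚᵘP.≃-trans
  (ℚP.toℚᵘ-homo-* (fromℤ a) (fromℤ b)) (ℚᵘ.*≡* cross)))
  where
  cross : (a ℤ.* b) ℤ.* + 1 ≡ (a ℤ.* b) ℤ.* (+ 1 ℤ.* + 1)
  cross = ℤ-Solver.solve (a ∷ b ∷ [])

fromℕ-+ : ∀ m n → fromℕ (m ℕ.+ n) ≡ fromℕ m + fromℕ n
fromℕ-+ m n = trans (cong fromℤ (ℤP.pos-+ m n)) (fromℤ-+ (+ m) (+ n))

fromℕ-* : ∀ m n → fromℕ (m ℕ.* n) ≡ fromℕ m * fromℕ n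
fromℕ-* m n = trans (cong fromℤ (ℤP.pos-* m n)) (fromℤ-* (+ m) (+ n))

fromℤ-neg : ∀ a → fromℤ (ℤ.- a) ≡ - fromℤ a
fromℤ-neg (+ zero)  = refl
fromℤ-neg (+ suc n) = refl
fromℤ-neg ℤ.-[1+ n ] = refl

fromℕ-*-recip : ∀ n → fromℕ (suc n) * recip (suc n) ≡ 1ℚ
fromℕ-*-recip n = begin
  fromℕ (suc n) * recip (suc n)       ≡⟨ cong (fromℕ (suc n) *_) recip≡1/ ⟩
  fromℕ (suc n) * ℚ.1/ fromℕ (suc n)  ≡⟨ ℚP.*-inverseʳ (fromℕ (suc n)) ⟩
  1ℚ                                  ∎
  where
  open ≡-Reasoning
  recip≡1/ : recip (suc n) ≡ ℚ.1/ fromℕ (suc n)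
  recip≡1/ = ℚP.normalize-coprime (1-coprimeTo (suc n))

recip-unique : ∀ n → fromℕ (suc n) * x ≡ 1ℚ → x ≡ recip (suc n)
recip-unique {x} n nx≡1 = begin
  x                ≡⟨ ℚP.*-identityˡ x ⟨
  1ℚ * x           ≡⟨ cong (_* x) (trans (ℚP.*-comm r N) (fromℕ-*-recip n)) ⟨
  r * N * x        ≡⟨ ℚP.*-assoc r N x ⟩
  r * (N * x)      ≡⟨ cong (r *_) nx≡1 ⟩
  r * 1ℚ           ≡⟨ ℚP.*-identityʳ r ⟩
  r                ∎
  where
  open ≡-Reasoning
  N = fromℕ (suc n)
  r = recip (suc n)

recip-* : ∀ m n → recip (suc m ℕ.* suc n) ≡ recip (suc m) * recip (suc n)
recip-* m n = sym (recip-unique (n ℕ.+ m ℕ.* suc n) (begin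
  fromℕ (suc m ℕ.* suc n) * (rm * rn)  ≡⟨ cong (_* (rm * rn)) (fromℕ-* (suc m) (suc n)) ⟩
  (M * K) * (rm * rn)                  ≡⟨ *-interchange M K rm rn ⟩
  (M * rm) * (K * rn)                  ≡⟨ cong₂ _*_ (fromℕ-*-recip m) (fromℕ-*-recip n) ⟩
  1ℚ * 1ℚ                              ≡⟨ ℚP.*-identityˡ 1ℚ ⟩
  1ℚ                                   ∎))
  where
  open ≡-Reasoning
  M = fromℕ (suc m)
  K = fromℕ (suc n)
  rm = recip (suc m)
  rn = recip (suc n)

fromℕ-*-[recip-+-recip] : ∀ m n →
  fromℕ (suc m ℕ.* suc n) * (recip (suc m) + recip (suc n)) ≡ fromℕ (suc m ℕ.+ suc n)
fromℕ-*-[recip-+-recip] m n = begin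
  fromℕ (suc m ℕ.* suc n) * (rm + rn)  ≡⟨ cong (_* (rm + rn)) (fromℕ-* (suc m) (suc n)) ⟩
  M * K * (rm + rn)                    ≡⟨ distribute M K rm rn ⟩
  K * (M * rm) + M * (K * rn)          ≡⟨ cong₂ (λ a b → K * a + M * b)
                                              (fromℕ-*-recip m) (fromℕ-*-recip n) ⟩
  K * 1ℚ + M * 1ℚ                      ≡⟨ collect K M ⟩
  M + K                                ≡⟨ fromℕ-+ (suc m) (suc n) ⟨
  fromℕ (suc m ℕ.+ suc n)              ∎
  where
  open ≡-Reasoning
  M = fromℕ (suc m)
  K = fromℕ (suc n)
  rm = recip (suc m)
  rn = recip (suc n)
  distribute : ∀ a b c d → a * b * (c + d) ≡ b * (a * c) + a * (b * d)
  distribute = solve-∀ ℚ-ring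
  collect : ∀ a b → a * 1ℚ + b * 1ℚ ≡ b + a
  collect = solve-∀ ℚ-ring

sum-pointwise : (_∼_ : ℚ → ℚ → Set) → 0ℚ ∼ 0ℚ →
  (∀ {x x′ y y′} → x ∼ x′ → y ∼ y′ → (x + y) ∼ (x′ + y′)) →
  ∀ n {f g : ℕ → ℚ} → (∀ k → 1 ≤ k → k ≤ n → f k ∼ g k) → sumFrom1 n f ∼ sumFrom1 n g
sum-pointwise _∼_ 0∼0 +-cong zero    f∼g = 0∼0
sum-pointwise _∼_ 0∼0 +-cong (suc n) f∼g = +-cong
  (sum-pointwise _∼_ 0∼0 +-cong n (λ k 1≤k k≤n → f∼g k 1≤k (ℕP.m≤n⇒m≤1+n k≤n)))
  (f∼g (suc n) (s≤s z≤n) ℕP.≤-refl)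

sum-cong : ∀ n {f g : ℕ → ℚ} → (∀ k → 1 ≤ k → k ≤ n → f k ≡ g k) →
           sumFrom1 n f ≡ sumFrom1 n g
sum-cong = sum-pointwise _≡_ refl (cong₂ _+_)

sum-+ : ∀ n (f g : ℕ → ℚ) → sumFrom1 n (λ k → f k + g k) ≡ sumFrom1 n f + sumFrom1 n g
sum-+ zero    f g = refl
sum-+ (suc n) f g = trans (cong (_+ (f (suc n) + g (suc n))) (sum-+ n f g))
  (+-interchange (sumFrom1 n f) (sumFrom1 n g) (f (suc n)) (g (suc n)))
  where
  +-interchange : ∀ a b c d → (a + b) + (c + d) ≡ (a + c) + (b + d)
  +-interchange = solve-∀ ℚ-ring

sum-*ʳ : ∀ n (f : ℕ → ℚ) c → sumFrom1 n (λ k → f k * c) ≡ sumFrom1 n f * c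
sum-*ʳ zero    f c = sym (ℚP.*-zeroˡ c)
sum-*ʳ (suc n) f c = trans (cong (_+ f (suc n) * c) (sum-*ʳ n f c))
  (sym (ℚP.*-distribʳ-+ c (sumFrom1 n f) (f (suc n))))

sum-neg : ∀ n (f : ℕ → ℚ) → sumFrom1 n (λ k → - f k) ≡ - sumFrom1 n f
sum-neg zero    f = refl
sum-neg (suc n) f = trans (cong (_+ - f (suc n)) (sum-neg n f))
  (sym (ℚP.neg-distrib-+ (sumFrom1 n f) (f (suc n))))

sum-shift : ∀ n (f : ℕ → ℚ) → sumFrom1 (suc n) f ≡ f 1 + sumFrom1 n (λ k → f (suc k))
sum-shift zero    f = trans (ℚP.+-identityˡ (f 1)) (sym (ℚP.+-identityʳ (f 1)))
sum-shift (suc n) f = trans (cong (_+ f (2 ℕ.+ n)) (sum-shift n f))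
  (ℚP.+-assoc (f 1) (sumFrom1 n (λ k → f (suc k))) (f (2 ℕ.+ n)))

sum-reverse : ∀ n (f : ℕ → ℚ) → sumFrom1 n f ≡ sumFrom1 n (λ k → f (suc n ∸ k))
sum-reverse zero    f = refl
sum-reverse (suc n) f = begin
  sumFrom1 n f + f (suc n)                             ≡⟨ cong (_+ f (suc n)) (sum-reverse n f) ⟩
  sumFrom1 n (λ k → f (suc n ∸ k)) + f (suc n)         ≡⟨ ℚP.+-comm _ (f (suc n)) ⟩
  f (suc n) + sumFrom1 n (λ k → f (suc n ∸ k))         ≡⟨ sum-shift n (λ k → f (2 ℕ.+ n ∸ k)) ⟨
  sumFrom1 (suc n) (λ k → f (2 ℕ.+ n ∸ k))             ∎
  where open ≡-Reasoning

sum-split : ∀ m n (f : ℕ → ℚ) →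
            sumFrom1 (m ℕ.+ n) f ≡ sumFrom1 m f + sumFrom1 n (λ k → f (m ℕ.+ k))
sum-split m zero    f = trans (cong (λ t → sumFrom1 t f) (ℕP.+-identityʳ m)) (sym (ℚP.+-identityʳ _))
sum-split m (suc n) f = begin
  sumFrom1 (m ℕ.+ suc n) f                                         ≡⟨ cong (λ t → sumFrom1 t f) (ℕP.+-suc m n) ⟩
  sumFrom1 (m ℕ.+ n) f + f (suc (m ℕ.+ n))                         ≡⟨ cong₂ _+_ (sum-split m n f)
                                                                                (cong f (sym (ℕP.+-suc m n))) ⟩
  sumFrom1 m f + sumFrom1 n (λ k → f (m ℕ.+ k)) + f (m ℕ.+ suc n)  ≡⟨ ℚP.+-assoc (sumFrom1 m f) _ _ ⟩
  sumFrom1 m f + sumFrom1 (suc n) (λ k → f (m ℕ.+ k))              ∎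
  where open ≡-Reasoning

sum-even-odd : ∀ q (f : ℕ → ℚ) →
  sumFrom1 (q ℕ.+ q) f ≡ sumFrom1 q (λ k → f (2 ℕ.* k)) + sumFrom1 q (λ k → f (2 ℕ.* k ∸ 1))
sum-even-odd zero    f = refl
sum-even-odd (suc q) f = begin
  sumFrom1 (suc q ℕ.+ suc q) f                       ≡⟨ cong (λ t → sumFrom1 t f) (cong suc (ℕP.+-suc q q)) ⟩
  sumFrom1 (q ℕ.+ q) f + f odd + f even              ≡⟨ cong (λ t → t + f odd + f even) (sum-even-odd q f) ⟩
  E + O + f odd + f even                             ≡⟨ regroup E O (f odd) (f even) ⟩
  (E + f even) + (O + f odd)                         ≡⟨ cong₂ (λ a b → (E + f a) + (O + f b))
                                                              even≡ (cong (_∸ 1) even≡) ⟩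
  (E + f (2 ℕ.* suc q)) + (O + f (2 ℕ.* suc q ∸ 1))  ∎
  where
  open ≡-Reasoning
  odd = suc (q ℕ.+ q)
  even = suc odd
  E = sumFrom1 q (λ k → f (2 ℕ.* k))
  O = sumFrom1 q (λ k → f (2 ℕ.* k ∸ 1))
  even≡ : even ≡ 2 ℕ.* suc q
  even≡ = trans (cong (λ t → suc (suc (q ℕ.+ t))) (sym (ℕP.+-identityʳ q)))
    (sym (cong suc (ℕP.+-suc q (q ℕ.+ 0))))
  regroup : ∀ a b c d → a + b + c + d ≡ (a + d) + (b + c)
  regroup = solve-∀ ℚ-ring

even-or-odd : ∀ n → ∃[ q ] (n ≡ q ℕ.+ q ⊎ n ≡ suc (q ℕ.+ q))
even-or-odd zero    = 0 , inj₁ refl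
even-or-odd (suc n) with even-or-odd n
... | q , inj₁ n≡q+q = q , inj₂ (cong suc n≡q+q)
... | q , inj₂ n≡1+q+q = suc q , inj₁ (trans (cong suc n≡1+q+q) (cong suc (sym (ℕP.+-suc q q))))

double-suc : ∀ n → 2 ℕ.* suc n ≡ suc (suc (n ℕ.+ n))
double-suc = ℕ-Solver.solve-∀

reflect-upper-half : ∀ q k → k ≤ suc q → q ℕ.+ (suc q ∸ k) ≡ suc (q ℕ.+ q) ∸ k
reflect-upper-half q k k≤1+q = trans (sym (ℕP.+-∸-assoc q k≤1+q)) (cong (_∸ k) (ℕP.+-suc q q))

reflect-odd : ∀ q k → k ≤ q → 2 ℕ.* (suc q ∸ k) ∸ 1 ≡ suc (q ℕ.+ q) ∸ 2 ℕ.* k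
reflect-odd _ k k≤q with ℕP.m≤n⇒∃[o]m+o≡n k≤q
... | d , refl = begin
  2 ℕ.* (suc (k ℕ.+ d) ∸ k) ∸ 1           ≡⟨ cong (λ t → 2 ℕ.* (t ∸ k) ∸ 1) (sym (ℕP.+-suc k d)) ⟩
  2 ℕ.* (k ℕ.+ suc d ∸ k) ∸ 1             ≡⟨ cong (λ t → 2 ℕ.* t ∸ 1) (ℕP.m+n∸m≡n k (suc d)) ⟩
  2 ℕ.* suc d ∸ 1                         ≡⟨ cong (_∸ 1) (double-suc d) ⟩
  suc (d ℕ.+ d)                           ≡⟨ ℕP.m+n∸m≡n (2 ℕ.* k) (suc (d ℕ.+ d)) ⟨
  2 ℕ.* k ℕ.+ suc (d ℕ.+ d) ∸ 2 ℕ.* k     ≡⟨ cong (_∸ 2 ℕ.* k) (regroup k d) ⟩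
  suc ((k ℕ.+ d) ℕ.+ (k ℕ.+ d)) ∸ 2 ℕ.* k ∎
  where
  open ≡-Reasoning
  regroup : ∀ k d → 2 ℕ.* k ℕ.+ suc (d ℕ.+ d) ≡ suc ((k ℕ.+ d) ℕ.+ (k ℕ.+ d))
  regroup = ℕ-Solver.solve-∀

recip⁴ : ℕ → ℚ
recip⁴ k = recip k * recip k * recip k * recip k

recip⁴-2* : ∀ k → 1 ≤ k → recip⁴ (2 ℕ.* k) ≡ recip⁴ k * recip⁴ 2
recip⁴-2* (suc k) _ = trans (cong (λ r → r * r * r * r) (recip-* 1 k)) (fourth-power (recip 2) (recip (suc k)))
  where
  fourth-power : ∀ a b → (a * b) * (a * b) * (a * b) * (a * b) ≡ (b * b * b * b) * (a * a * a * a)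
  fourth-power = solve-∀ ℚ-ring

H-suc : n ≡ suc m → H n ≡ H m + recip n
H-suc refl = refl

-- Multiple harmonic sums H(s₁,…,sᵣ) n = Σ_{1≤k₁<⋯<kᵣ≤n} 1/(k₁^s₁ ⋯ kᵣ^sᵣ).
H₁₂ H₁₃ H₄ H₁₂₁ : ℕ → ℚ
H₁₂ n = sumFrom1 n (λ j → H (j ∸ 1) * recip j * recip j)
H₁₃ n = sumFrom1 n (λ j → H (j ∸ 1) * recip j * recip j * recip j)
H₄ n = sumFrom1 n recip⁴
H₁₂₁ n = sumFrom1 n (λ k → H₁₂ (k ∸ 1) * recip k)

tripleSum≡H₁₂₁ : ∀ n → tripleSum (suc n) ≡ H₁₂₁ n
tripleSum≡H₁₂₁ n = sum-cong n λ k _ _ →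
  trans (sum-cong (k ∸ 1) (λ j _ _ → sum-*³ (j ∸ 1) (recip j) (recip j) (recip k)))
        (sum-*ʳ (k ∸ 1) (λ j → H (j ∸ 1) * recip j * recip j) (recip k))
  where
  sum-*³ : ∀ n a b c → sumFrom1 n (λ i → recip i * a * b * c) ≡ H n * a * b * c
  sum-*³ n a b c = trans (sum-*ʳ n (λ i → recip i * a * b) c)
    (cong (_* c) (trans (sum-*ʳ n (λ i → recip i * a) b) (cong (_* b) (sum-*ʳ n recip a))))

lhs+H₁₂₁ : ∀ n → lhs (suc n) + H₁₂₁ n ≡ H n * H₁₂ n + H₁₃ n + H₄ n
lhs+H₁₂₁ zero    = refl
lhs+H₁₂₁ (suc n) = begin
  (lhs (suc n) + h′ * h′ * r * r) + (H₁₂₁ n + H₁₂ n * r)  ≡⟨ interchange (lhs (suc n)) (H₁₂₁ n) _ _ ⟩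
  (lhs (suc n) + H₁₂₁ n) + (h′ * h′ * r * r + H₁₂ n * r)  ≡⟨ cong (_+ (h′ * h′ * r * r + H₁₂ n * r)) (lhs+H₁₂₁ n) ⟩
  (H n * H₁₂ n + H₁₃ n + H₄ n) + (h′ * h′ * r * r + H₁₂ n * r)
                                                         ≡⟨ step (H n) (H₁₂ n) (H₁₃ n) (H₄ n) r ⟩
  h′ * H₁₂ (suc n) + H₁₃ (suc n) + H₄ (suc n)             ∎
  where
  open ≡-Reasoning
  r = recip (suc n)
  h′ = H (suc n)
  interchange : ∀ a b c d → (a + c) + (b + d) ≡ (a + b) + (c + d)
  interchange = solve-∀ ℚ-ring
  step : ∀ h P Q R r → (h * P + Q + R) + ((h + r) * (h + r) * r * r + P * r)
                     ≡ (h + r) * (P + h * r * r) + (Q + h * r * r * r) + (R + r * r * r * r)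
  step = solve-∀ ℚ-ring

module Localisation {p : ℕ} (p-prime : Prime p) where

  p∤1 : p ∤ 1
  p∤1 = >⇒∤ (ℕ.nonTrivial⇒n>1 p {{prime⇒nonTrivial p-prime}})

  p∤-* : p ∤ m → p ∤ n → p ∤ m ℕ.* n
  p∤-* {m} {n} p∤m p∤n p∣mn with euclidsLemma m n p-prime p∣mn
  ... | inj₁ p∣m = p∤m p∣m
  ... | inj₂ p∣n = p∤n p∣n

  -- u ∣ₚ x says that x lies in u ℤ₍ₚ₎: b x = u a for an integer a and some b with p ∤ b.
  infix 4 _∣ₚ_
  record _∣ₚ_ (u x : ℚ) : Set where
    constructor mk∣ₚ
    field
      unit     : ℕ
      p∤unit   : p ∤ unit
      quotient : ℤ
      equation : fromℕ unit * x ≡ u * fromℤ quotient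

  Integral : ℚ → Set
  Integral = 1ℚ ∣ₚ_

  ∣ₚ-zero : u ∣ₚ 0ℚ
  ∣ₚ-zero {u} = mk∣ₚ 1 p∤1 (+ 0) (trans (ℚP.*-zeroʳ (fromℕ 1)) (sym (ℚP.*-zeroʳ u)))

  ∣ₚ-+ : u ∣ₚ x → u ∣ₚ y → u ∣ₚ x + y
  ∣ₚ-+ {u} {x} {y} (mk∣ₚ b p∤b a bx≡ua) (mk∣ₚ d p∤d c dy≡uc) =
    mk∣ₚ (b ℕ.* d) (p∤-* p∤b p∤d) (+ d ℤ.* a ℤ.+ + b ℤ.* c) (begin
      fromℕ (b ℕ.* d) * (x + y)                    ≡⟨ cong (_* (x + y)) (fromℕ-* b d) ⟩
      fromℕ b * fromℕ d * (x + y)                  ≡⟨ distribute (fromℕ b) (fromℕ d) x y ⟩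
      fromℕ d * (fromℕ b * x) + fromℕ b * (fromℕ d * y)
                                                   ≡⟨ cong₂ (λ s t → fromℕ d * s + fromℕ b * t) bx≡ua dy≡uc ⟩
      fromℕ d * (u * fromℤ a) + fromℕ b * (u * fromℤ c)
                                                   ≡⟨ factor u (fromℕ d) (fromℤ a) (fromℕ b) (fromℤ c) ⟩
      u * (fromℕ d * fromℤ a + fromℕ b * fromℤ c)  ≡⟨ cong (u *_) (cong₂ _+_ (fromℤ-* (+ d) a)
                                                                            (fromℤ-* (+ b) c)) ⟨
      u * (fromℤ (+ d ℤ.* a) + fromℤ (+ b ℤ.* c))  ≡⟨ cong (u *_) (fromℤ-+ (+ d ℤ.* a) (+ b ℤ.* c)) ⟨
      u * fromℤ (+ d ℤ.* a ℤ.+ + b ℤ.* c)          ∎)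
    where
    open ≡-Reasoning
    distribute : ∀ b d x y → b * d * (x + y) ≡ d * (b * x) + b * (d * y)
    distribute = solve-∀ ℚ-ring
    factor : ∀ u d a b c → d * (u * a) + b * (u * c) ≡ u * (d * a + b * c)
    factor = solve-∀ ℚ-ring

  ∣ₚ-neg : u ∣ₚ x → u ∣ₚ - x
  ∣ₚ-neg {u} {x} (mk∣ₚ b p∤b a bx≡ua) = mk∣ₚ b p∤b (ℤ.- a) (begin
    fromℕ b * - x        ≡⟨ ℚP.neg-distribʳ-* (fromℕ b) x ⟨
    - (fromℕ b * x)      ≡⟨ cong -_ bx≡ua ⟩
    - (u * fromℤ a)      ≡⟨ ℚP.neg-distribʳ-* u (fromℤ a) ⟩
    u * - fromℤ a        ≡⟨ cong (u *_) (fromℤ-neg a) ⟨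
    u * fromℤ (ℤ.- a)    ∎)
    where open ≡-Reasoning

  ∣ₚ-*ʳ : u ∣ₚ x → Integral y → u ∣ₚ x * y
  ∣ₚ-*ʳ {u} {x} {y} (mk∣ₚ b p∤b a bx≡ua) (mk∣ₚ d p∤d c dy≡c) =
    mk∣ₚ (b ℕ.* d) (p∤-* p∤b p∤d) (a ℤ.* c) (begin
      fromℕ (b ℕ.* d) * (x * y)            ≡⟨ cong (_* (x * y)) (fromℕ-* b d) ⟩
      (fromℕ b * fromℕ d) * (x * y)        ≡⟨ *-interchange (fromℕ b) (fromℕ d) x y ⟩
      (fromℕ b * x) * (fromℕ d * y)        ≡⟨ cong₂ _*_ bx≡ua dy≡c ⟩
      (u * fromℤ a) * (1ℚ * fromℤ c)       ≡⟨ cong ((u * fromℤ a) *_) (ℚP.*-identityˡ (fromℤ c)) ⟩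
      (u * fromℤ a) * fromℤ c              ≡⟨ ℚP.*-assoc u (fromℤ a) (fromℤ c) ⟩
      u * (fromℤ a * fromℤ c)              ≡⟨ cong (u *_) (fromℤ-* a c) ⟨
      u * fromℤ (a ℤ.* c)                  ∎)
    where open ≡-Reasoning

  ∣ₚ-trans : u ∣ₚ v → v ∣ₚ x → u ∣ₚ x
  ∣ₚ-trans {u} {v} {x} (mk∣ₚ d p∤d c dv≡uc) (mk∣ₚ b p∤b a bx≡va) =
    mk∣ₚ (d ℕ.* b) (p∤-* p∤d p∤b) (c ℤ.* a) (begin
      fromℕ (d ℕ.* b) * x          ≡⟨ cong (_* x) (fromℕ-* d b) ⟩
      fromℕ d * fromℕ b * x        ≡⟨ ℚP.*-assoc (fromℕ d) (fromℕ b) x ⟩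
      fromℕ d * (fromℕ b * x)      ≡⟨ cong (fromℕ d *_) bx≡va ⟩
      fromℕ d * (v * fromℤ a)      ≡⟨ ℚP.*-assoc (fromℕ d) v (fromℤ a) ⟨
      fromℕ d * v * fromℤ a        ≡⟨ cong (_* fromℤ a) dv≡uc ⟩
      u * fromℤ c * fromℤ a        ≡⟨ ℚP.*-assoc u (fromℤ c) (fromℤ a) ⟩
      u * (fromℤ c * fromℤ a)      ≡⟨ cong (u *_) (fromℤ-* c a) ⟨
      u * fromℤ (c ℤ.* a)          ∎)
    where open ≡-Reasoning

  ∣ₚ-cancel : p ∤ n → u ∣ₚ fromℕ n * x → u ∣ₚ x
  ∣ₚ-cancel {n} {u} {x} p∤n (mk∣ₚ b p∤b a bnx≡ua) = mk∣ₚ (b ℕ.* n) (p∤-* p∤b p∤n) a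
    (trans (cong (_* x) (fromℕ-* b n)) (trans (ℚP.*-assoc (fromℕ b) (fromℕ n) x) bnx≡ua))

  fromℤ-integral : ∀ a → Integral (fromℤ a)
  fromℤ-integral a = mk∣ₚ 1 p∤1 a refl

  recip-integral : k < p → Integral (recip k)
  recip-integral {zero}  _   = fromℤ-integral (+ 1)
  recip-integral {suc k} k<p = mk∣ₚ (suc k) (>⇒∤ k<p) (+ 1) (fromℕ-*-recip k)

  sum-∣ₚ : ∀ n {f : ℕ → ℚ} → (∀ k → 1 ≤ k → k ≤ n → u ∣ₚ f k) → u ∣ₚ sumFrom1 n f
  sum-∣ₚ {u} n {f} = sum-pointwise (λ x _ → u ∣ₚ x) ∣ₚ-zero ∣ₚ-+ n {f} {f}

  H-integral : n < p → Integral (H n)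
  H-integral n<p = sum-∣ₚ _ (λ k _ k≤n → recip-integral (ℕP.≤-<-trans k≤n n<p))

  p∣-cancel : ∀ {b} {n} m → p ∤ b → + b ℤ.* n ≡ + p ℤ.* m → p ∣ ℤ.∣ n ∣
  p∣-cancel {b} {n} m p∤b bn≡pm with euclidsLemma b ℤ.∣ n ∣ p-prime p∣bn
    where
    p∣bn : p ∣ b ℕ.* ℤ.∣ n ∣
    p∣bn = subst (p ∣_)
      (trans (sym (ℤP.abs-* (+ p) m)) (trans (cong ℤ.∣_∣ (sym bn≡pm)) (ℤP.abs-* (+ b) n)))
      (m∣m*n ℤ.∣ m ∣)
  ... | inj₁ p∣b = ⊥-elim (p∤b p∣b)
  ... | inj₂ p∣n = p∣n

  -- The equation is compared in ℚᵘ, whose product does not normalise.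
  divisible⇒p∣numerator : fromℕ p ∣ₚ x → + p ℤ.∣ ↥ x
  divisible⇒p∣numerator {x@(mkℚ n d _)} (mk∣ₚ b p∤b a bx≡pa) with
    ℚᵘP.≃-trans (ℚᵘP.≃-sym (ℚP.toℚᵘ-homo-* (fromℕ b) x))
      (ℚᵘP.≃-trans (ℚᵘP.≃-reflexive (cong ℚ.toℚᵘ bx≡pa)) (ℚP.toℚᵘ-homo-* (fromℕ p) (fromℤ a)))
  ... | ℚᵘ.*≡* cross =
    p∣-cancel _ p∤b (trans (sym (ℤP.*-identityʳ _)) (trans cross (ℤP.*-assoc (+ p) a _)))

  infix 4 _≈_
  record _≈_ (x y : ℚ) : Set where
    constructor mk≈
    field difference : fromℕ p ∣ₚ x - y
  open _≈_

  ≈⇒≡[modℚ] : x ≈ y → x ≡ y [modℚ p ]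
  ≈⇒≡[modℚ] = divisible⇒p∣numerator ∘ difference

  divisible⇒≈0 : fromℕ p ∣ₚ x → x ≈ 0ℚ
  divisible⇒≈0 {x} = mk≈ ∘ subst (fromℕ p ∣ₚ_) (sym (ℚP.+-identityʳ x))

  ≈0⇒divisible : x ≈ 0ℚ → fromℕ p ∣ₚ x
  ≈0⇒divisible {x} = subst (fromℕ p ∣ₚ_) (ℚP.+-identityʳ x) ∘ difference

  ≈-reflexive : x ≡ y → x ≈ y
  ≈-reflexive {x} refl = mk≈ (subst (fromℕ p ∣ₚ_) (sym (ℚP.+-inverseʳ x)) ∣ₚ-zero)

  ≈-refl : x ≈ x
  ≈-refl = ≈-reflexive refl

  ≈-sym : x ≈ y → y ≈ x
  ≈-sym {x} {y} (mk≈ x-y) = mk≈ (subst (fromℕ p ∣ₚ_) (negate x y) (∣ₚ-neg x-y))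
    where
    negate : ∀ x y → - (x - y) ≡ y - x
    negate = solve-∀ ℚ-ring

  ≈-trans : x ≈ y → y ≈ w → x ≈ w
  ≈-trans {x} {y} {w} (mk≈ x-y) (mk≈ y-w) =
    mk≈ (subst (fromℕ p ∣ₚ_) (telescope x y w) (∣ₚ-+ x-y y-w))
    where
    telescope : ∀ x y w → (x - y) + (y - w) ≡ x - w
    telescope = solve-∀ ℚ-ring

  ≈-setoid : Setoid 0ℓ 0ℓ
  ≈-setoid = record
    { Carrier = ℚ
    ; _≈_ = _≈_
    ; isEquivalence = record { refl = ≈-refl ; sym = ≈-sym ; trans = ≈-trans }
    }

  module ≈-Reasoning = SetoidReasoning ≈-setoid

  +-cong : x ≈ x′ → y ≈ y′ → x + y ≈ x′ + y′
  +-cong {x} {x′} {y} {y′} (mk≈ x-x′) (mk≈ y-y′) =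
    mk≈ (subst (fromℕ p ∣ₚ_) (regroup x x′ y y′) (∣ₚ-+ x-x′ y-y′))
    where
    regroup : ∀ x x′ y y′ → (x - x′) + (y - y′) ≡ (x + y) - (x′ + y′)
    regroup = solve-∀ ℚ-ring

  ≈-integral : x ≈ y → Integral y → Integral x
  ≈-integral {x} {y} (mk≈ x-y) int-y =
    subst Integral (cancel x y) (∣ₚ-+ (∣ₚ-trans (fromℤ-integral (+ p)) x-y) int-y)
    where
    cancel : ∀ x y → x - y + y ≡ x
    cancel = solve-∀ ℚ-ring

  *-cong : Integral x′ → Integral y′ → x ≈ x′ → y ≈ y′ → x * y ≈ x′ * y′
  *-cong {x′} {y′} {x} {y} int-x′ int-y′ x≈x′@(mk≈ x-x′) y≈y′@(mk≈ y-y′) =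
    mk≈ (subst (fromℕ p ∣ₚ_) (expand x x′ y y′)
      (∣ₚ-+ (∣ₚ-*ʳ x-x′ (≈-integral y≈y′ int-y′))
            (subst (fromℕ p ∣ₚ_) (ℚP.*-comm (y - y′) x′) (∣ₚ-*ʳ y-y′ int-x′))))
    where
    expand : ∀ x x′ y y′ → (x - x′) * y + x′ * (y - y′) ≡ x * y - x′ * y′
    expand = solve-∀ ℚ-ring

  +-congˡ : ∀ z → x ≈ y → z + x ≈ z + y
  +-congˡ z = +-cong (≈-refl {x = z})

  +-congʳ : ∀ z → x ≈ y → x + z ≈ y + z
  +-congʳ z x≈y = +-cong x≈y (≈-refl {x = z})

  sum-≈ : ∀ n {f g : ℕ → ℚ} → (∀ k → 1 ≤ k → k ≤ n → f k ≈ g k) →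
          sumFrom1 n f ≈ sumFrom1 n g
  sum-≈ = sum-pointwise _≈_ ≈-refl +-cong

  ≈0-cancel : p ∤ n → fromℕ n * x ≈ 0ℚ → x ≈ 0ℚ
  ≈0-cancel p∤n = divisible⇒≈0 ∘ ∣ₚ-cancel p∤n ∘ ≈0⇒divisible

  +≈0⇒≈- : x + y ≈ 0ℚ → x ≈ - y
  +≈0⇒≈- {x} {y} (mk≈ d) = mk≈ (subst (fromℕ p ∣ₚ_) (rearrange x y) d)
    where
    rearrange : ∀ x y → x + y - 0ℚ ≡ x - - y
    rearrange = solve-∀ ℚ-ring

  ≈-⇒+≈0 : x ≈ - y → x + y ≈ 0ℚ
  ≈-⇒+≈0 {x} {y} (mk≈ d) = mk≈ (subst (fromℕ p ∣ₚ_) (rearrange x y) d)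
    where
    rearrange : ∀ x y → x - - y ≡ x + y - 0ℚ
    rearrange = solve-∀ ℚ-ring

  neg-cong : x ≈ y → - x ≈ - y
  neg-cong {x} {y} (mk≈ x-y) = mk≈ (subst (fromℕ p ∣ₚ_) (negate x y) (∣ₚ-neg x-y))
    where
    negate : ∀ x y → - (x - y) ≡ - x - - y
    negate = solve-∀ ℚ-ring

  *-congˡ : Integral u → x ≈ y → u * x ≈ u * y
  *-congˡ {u} {x} {y} int-u (mk≈ x-y) =
    mk≈ (subst (fromℕ p ∣ₚ_) (distribute u x y) (∣ₚ-*ʳ x-y int-u))
    where
    distribute : ∀ u x y → (x - y) * u ≡ u * x - u * y
    distribute = solve-∀ ℚ-ring

  *-cube-cong : Integral x′ → Integral y′ → x ≈ x′ → y ≈ y′ →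
                x * y * y * y ≈ x′ * y′ * y′ * y′
  *-cube-cong int-x′ int-y′ x≈x′ y≈y′ =
    *-cong int-x′y′y′ int-y′ (*-cong int-x′y′ int-y′ (*-cong int-x′ int-y′ x≈x′ y≈y′) y≈y′) y≈y′
    where
    int-x′y′ = ∣ₚ-*ʳ int-x′ int-y′
    int-x′y′y′ = ∣ₚ-*ʳ int-x′y′ int-y′

  ≈0-*ʳ : x ≈ 0ℚ → Integral y → x * y ≈ 0ℚ
  ≈0-*ʳ x≈0 int-y = divisible⇒≈0 (∣ₚ-*ʳ (≈0⇒divisible x≈0) int-y)

  recip-+-recip-divisible : ∀ m n → 1 ≤ m → 1 ≤ n → m ℕ.+ n ≡ p → fromℕ p ∣ₚ recip m + recip n
  recip-+-recip-divisible (suc m) (suc n) _ _ m+n≡p =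
    mk∣ₚ (suc m ℕ.* suc n) (p∤-* (>⇒∤ m<p) (>⇒∤ n<p)) (+ 1)
      (trans (fromℕ-*-[recip-+-recip] m n) (trans (cong fromℕ m+n≡p) (sym (ℚP.*-identityʳ (fromℕ p)))))
    where
    m<p : suc m < p
    m<p = subst (suc m <_) m+n≡p (ℕP.m<m+n (suc m) (s≤s z≤n))
    n<p : suc n < p
    n<p = subst (suc n <_) m+n≡p (ℕP.m<n+m (suc n) (s≤s z≤n))

module Reflection {N : ℕ} (p-prime : Prime (suc N)) where
  open Localisation p-prime

  p : ℕ
  p = suc N

  recip-reflect-divisible : ∀ k → 1 ≤ k → k ≤ N → fromℕ p ∣ₚ recip (p ∸ k) + recip k
  recip-reflect-divisible k 1≤k k≤N = recip-+-recip-divisible (p ∸ k) k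
    (ℕP.m<n⇒0<n∸m (s≤s k≤N)) 1≤k (ℕP.m∸n+n≡m (ℕP.m≤n⇒m≤1+n k≤N))

  recip-reflect : ∀ k → 1 ≤ k → k ≤ N → recip (p ∸ k) ≈ - recip k
  recip-reflect k 1≤k k≤N = +≈0⇒≈- (divisible⇒≈0 (recip-reflect-divisible k 1≤k k≤N))

  H≈0 : p ∤ 2 → H N ≈ 0ℚ
  H≈0 p∤2 = ≈0-cancel p∤2 (divisible⇒≈0
    (subst (fromℕ p ∣ₚ_) pair-sum (sum-∣ₚ N recip-reflect-divisible)))
    where
    open ≡-Reasoning
    pair-sum : sumFrom1 N (λ k → recip (p ∸ k) + recip k) ≡ fromℕ 2 * H N
    pair-sum = begin
      sumFrom1 N (λ k → recip (p ∸ k) + recip k)      ≡⟨ sum-+ N (λ k → recip (p ∸ k)) recip ⟩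
      sumFrom1 N (λ k → recip (p ∸ k)) + H N          ≡⟨ cong (_+ H N) (sum-reverse N recip) ⟨
      H N + H N                                       ≡⟨ double (H N) ⟩
      fromℕ 2 * H N                                   ∎
      where
      double : ∀ x → x + x ≡ fromℕ 2 * x
      double = solve-∀ ℚ-ring

  H-reflect : p ∤ 2 → ∀ k → k ≤ N → H (N ∸ k) ≈ H k
  H-reflect p∤2 zero    _   = H≈0 p∤2
  H-reflect p∤2 (suc k) k<N = begin
    H (N ∸ suc k)                            ≡⟨ add-sub (H (N ∸ suc k)) (recip (N ∸ k)) ⟩
    H (N ∸ suc k) + recip (N ∸ k) - recip (N ∸ k)
                                             ≡⟨ cong (_- recip (N ∸ k)) (H-suc (ℕP.+-∸-assoc 1 k<N)) ⟨
    H (N ∸ k) - recip (N ∸ k)                ≈⟨ +-cong (H-reflect p∤2 k (ℕP.<⇒≤ k<N))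
                                                        (neg-cong (recip-reflect (suc k) (s≤s z≤n) k<N)) ⟩
    H k - - recip (suc k)                    ≡⟨ sub-neg (H k) (recip (suc k)) ⟩
    H (suc k)                                ∎
    where
    open ≈-Reasoning
    add-sub : ∀ x y → x ≡ x + y - y
    add-sub = solve-∀ ℚ-ring
    sub-neg : ∀ x y → x - - y ≡ x + y
    sub-neg = solve-∀ ℚ-ring

  H₁₃≈-[H₁₃+H₄] : p ∤ 2 → H₁₃ N ≈ - (H₁₃ N + H₄ N)
  H₁₃≈-[H₁₃+H₄] p∤2 = begin
    H₁₃ N                                      ≡⟨ sum-reverse N term ⟩
    sumFrom1 N (λ k → term (p ∸ k))            ≈⟨ sum-≈ N reflect-term ⟩
    sumFrom1 N (λ k → - (H k * recip k * recip k * recip k))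
                                               ≡⟨ sum-neg N (λ k → H k * recip k * recip k * recip k) ⟩
    - sumFrom1 N (λ k → H k * recip k * recip k * recip k)
                                               ≡⟨ cong -_ (trans (sum-cong N split-H) (sum-+ N term recip⁴)) ⟩
    - (H₁₃ N + H₄ N)                           ∎
    where
    open ≈-Reasoning
    term : ℕ → ℚ
    term j = H (j ∸ 1) * recip j * recip j * recip j
    reflect-term : ∀ k → 1 ≤ k → k ≤ N → term (p ∸ k) ≈ - (H k * recip k * recip k * recip k)
    reflect-term (suc k) 1≤k k<N = begin
      H (N ∸ k ∸ 1) * r′ * r′ * r′  ≡⟨ cong (λ t → H t * r′ * r′ * r′) ∸1≡ ⟩
      H (N ∸ suc k) * r′ * r′ * r′  ≈⟨ *-cube-cong (H-integral (s≤s k<N)) (∣ₚ-neg (recip-integral (s≤s k<N)))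
                                         (H-reflect p∤2 (suc k) k<N) (recip-reflect (suc k) 1≤k k<N) ⟩
      H (suc k) * - r * - r * - r   ≡⟨ odd-power (H (suc k)) r ⟩
      - (H (suc k) * r * r * r)     ∎
      where
      r = recip (suc k)
      r′ = recip (N ∸ k)
      ∸1≡ : N ∸ k ∸ 1 ≡ N ∸ suc k
      ∸1≡ = trans (ℕP.∸-+-assoc N k 1) (cong (N ∸_) (ℕP.+-comm k 1))
      odd-power : ∀ h r → h * - r * - r * - r ≡ - (h * r * r * r)
      odd-power = solve-∀ ℚ-ring
    split-H : ∀ k → 1 ≤ k → k ≤ N → H k * recip k * recip k * recip k ≡ term k + recip⁴ k
    split-H (suc k) _ _ = distribute (H k) (recip (suc k))
      where
      distribute : ∀ h r → (h + r) * r * r * r ≡ h * r * r * r + r * r * r * r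
      distribute = solve-∀ ℚ-ring

  module _ (q : ℕ) (N≡q+q : N ≡ q ℕ.+ q) {f : ℕ → ℚ}
           (f-reflect : ∀ k → 1 ≤ k → k ≤ N → f (p ∸ k) ≈ f k) where

    private
      p≡ : p ≡ suc (q ℕ.+ q)
      p≡ = cong suc N≡q+q

      upper-index : ∀ k → k ≤ q → q ℕ.+ (suc q ∸ k) ≡ p ∸ k
      upper-index k k≤q = trans (reflect-upper-half q k (ℕP.m≤n⇒m≤1+n k≤q)) (cong (_∸ k) (sym p≡))

      odd-index : ∀ k → k ≤ q → 2 ℕ.* (suc q ∸ k) ∸ 1 ≡ p ∸ 2 ℕ.* k
      odd-index k k≤q = trans (reflect-odd q k k≤q) (cong (_∸ 2 ℕ.* k) (sym p≡))

      k≤N : ∀ {k} → k ≤ q → k ≤ N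
      k≤N {k} k≤q = subst (k ≤_) (sym N≡q+q) (ℕP.≤-trans k≤q (ℕP.m≤m+n q q))

      2k≤N : ∀ {k} → k ≤ q → 2 ℕ.* k ≤ N
      2k≤N {k} k≤q = subst (2 ℕ.* k ≤_) (sym N≡q+q)
        (subst (2 ℕ.* k ≤_) (cong (q ℕ.+_) (ℕP.+-identityʳ q)) (ℕP.*-monoʳ-≤ 2 k≤q))

    sum-≈-lower-half : sumFrom1 N f ≈ sumFrom1 q f + sumFrom1 q f
    sum-≈-lower-half = begin
      sumFrom1 N f                                   ≡⟨ cong (λ t → sumFrom1 t f) N≡q+q ⟩
      sumFrom1 (q ℕ.+ q) f                           ≡⟨ sum-split q q f ⟩
      A + sumFrom1 q (λ k → f (q ℕ.+ k))             ≡⟨ cong (_+_ A) (sum-reverse q _) ⟩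
      A + sumFrom1 q (λ k → f (q ℕ.+ (suc q ∸ k)))   ≡⟨ cong (_+_ A) (sum-cong q λ k _ k≤q →
                                                          cong f (upper-index k k≤q)) ⟩
      A + sumFrom1 q (λ k → f (p ∸ k))               ≈⟨ +-congˡ A (sum-≈ q λ k 1≤k k≤q →
                                                          f-reflect k 1≤k (k≤N k≤q)) ⟩
      A + A                                          ∎
      where
      open ≈-Reasoning
      A = sumFrom1 q f

    sum-≈-even-half : sumFrom1 N f ≈ sumFrom1 q (λ k → f (2 ℕ.* k)) + sumFrom1 q (λ k → f (2 ℕ.* k))
    sum-≈-even-half = begin
      sumFrom1 N f                                          ≡⟨ cong (λ t → sumFrom1 t f) N≡q+q ⟩
      sumFrom1 (q ℕ.+ q) f                                  ≡⟨ sum-even-odd q f ⟩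
      E + sumFrom1 q (λ k → f (2 ℕ.* k ∸ 1))                ≡⟨ cong (_+_ E) (sum-reverse q _) ⟩
      E + sumFrom1 q (λ k → f (2 ℕ.* (suc q ∸ k) ∸ 1))      ≡⟨ cong (_+_ E) (sum-cong q λ k _ k≤q →
                                                                 cong f (odd-index k k≤q)) ⟩
      E + sumFrom1 q (λ k → f (p ∸ 2 ℕ.* k))                ≈⟨ +-congˡ E (sum-≈ q λ k 1≤k k≤q →
                                                                 f-reflect (2 ℕ.* k) (ℕP.≤-trans 1≤k (ℕP.m≤n*m k 2))
                                                                                     (2k≤N k≤q)) ⟩
      E + E                                                 ∎
      where
      open ≈-Reasoning
      E = sumFrom1 q (λ k → f (2 ℕ.* k))

  H₄≈0 : p ∤ 15 → ∀ q → N ≡ q ℕ.+ q → H₄ N ≈ 0ℚ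
  H₄≈0 p∤15 q N≡q+q = ≈0-cancel p∤15 (begin
    fromℕ 15 * H₄ N                         ≡⟨ fifteen (H₄ N) ⟩
    fromℕ 16 * H₄ N - H₄ N                  ≈⟨ +-congʳ (- H₄ N) (*-congˡ (fromℤ-integral (+ 16))
                                                                 (sum-≈-even-half q N≡q+q recip⁴-reflect)) ⟩
    fromℕ 16 * (E + E) - H₄ N               ≡⟨ cong (λ t → fromℕ 16 * (t + t) - H₄ N) E≡A*c ⟩
    fromℕ 16 * (A * c + A * c) - H₄ N       ≡⟨ cong (_- H₄ N) (scale A c (fromℕ 16)) ⟩
    (A + A) * (fromℕ 16 * c) - H₄ N         ≡⟨ cong (λ t → (A + A) * t - H₄ N) 16*c≡1 ⟩
    (A + A) * 1ℚ - H₄ N                     ≡⟨ cong (_- H₄ N) (ℚP.*-identityʳ (A + A)) ⟩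
    A + A - H₄ N                            ≈⟨ +-congʳ (- H₄ N) (≈-sym (sum-≈-lower-half q N≡q+q recip⁴-reflect)) ⟩
    H₄ N - H₄ N                             ≡⟨ ℚP.+-inverseʳ (H₄ N) ⟩
    0ℚ                                      ∎)
    where
    open ≈-Reasoning
    A = sumFrom1 q recip⁴
    E = sumFrom1 q (λ k → recip⁴ (2 ℕ.* k))
    c = recip⁴ 2
    recip⁴-reflect : ∀ k → 1 ≤ k → k ≤ N → recip⁴ (p ∸ k) ≈ recip⁴ k
    recip⁴-reflect k 1≤k k≤N = ≈-trans
      (*-cube-cong int-neg int-neg (recip-reflect k 1≤k k≤N) (recip-reflect k 1≤k k≤N))
      (≈-reflexive (even-power (recip k)))
      where
      int-neg = ∣ₚ-neg (recip-integral (s≤s k≤N))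
      even-power : ∀ r → - r * - r * - r * - r ≡ r * r * r * r
      even-power = solve-∀ ℚ-ring
    E≡A*c : E ≡ A * c
    E≡A*c = trans (sum-cong q (λ k 1≤k _ → recip⁴-2* k 1≤k)) (sum-*ʳ q recip⁴ c)
    16*c≡1 : fromℕ 16 * c ≡ 1ℚ
    16*c≡1 = refl
    fifteen : ∀ x → fromℕ 15 * x ≡ fromℕ 16 * x - x
    fifteen = solve-∀ ℚ-ring
    scale : ∀ a c s → s * (a * c + a * c) ≡ (a + a) * (s * c)
    scale = solve-∀ ℚ-ring

  H₁₃≈0 : p ∤ 2 → H₄ N ≈ 0ℚ → H₁₃ N ≈ 0ℚ
  H₁₃≈0 p∤2 H₄≈0 = ≈0-cancel p∤2 (begin
    fromℕ 2 * H₁₃ N                  ≡⟨ double (H₁₃ N) ⟩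
    H₁₃ N + (H₁₃ N + 0ℚ)             ≈⟨ +-congˡ (H₁₃ N) (+-congˡ (H₁₃ N) (≈-sym H₄≈0)) ⟩
    H₁₃ N + (H₁₃ N + H₄ N)           ≈⟨ ≈-⇒+≈0 (H₁₃≈-[H₁₃+H₄] p∤2) ⟩
    0ℚ                               ∎)
    where
    open ≈-Reasoning
    double : ∀ x → fromℕ 2 * x ≡ x + (x + 0ℚ)
    double = solve-∀ ℚ-ring

  H₁₂-integral : Integral (H₁₂ N)
  H₁₂-integral = sum-∣ₚ N λ j _ j≤N →
    let int-recip = recip-integral (s≤s j≤N) in
    ∣ₚ-*ʳ (∣ₚ-*ʳ (H-integral (s≤s (ℕP.≤-trans (ℕP.m∸n≤m j 1) j≤N))) int-recip) int-recip

  N-even : p ∤ 2 → ∃[ q ] N ≡ q ℕ.+ q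
  N-even p∤2 with even-or-odd N
  ... | q , inj₁ N≡q+q   = q , N≡q+q
  ... | q , inj₂ N≡1+q+q = ⊥-elim (p∤-* p∤2 (>⇒∤ 1+q<p) (subst (p ∣_) p≡2[1+q] ∣-refl))
    where
    p≡2[1+q] : p ≡ 2 ℕ.* suc q
    p≡2[1+q] = trans (cong suc N≡1+q+q) (sym (double-suc q))
    1+q<p : suc q < p
    1+q<p = subst (suc q <_) (sym (cong suc N≡1+q+q)) (s≤s (s≤s (ℕP.m≤m+n q q)))

lemma2p8 : (p : ℕ) → Prime p → 7 ≤ p →
    lhs p ≡ - tripleSum p [modℚ p ]
lemma2p8 zero    _       ()
lemma2p8 (suc N) p-prime 7≤p = ≈⇒≡[modℚ] (+≈0⇒≈- {x = lhs p} {y = tripleSum p} (begin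
  lhs p + tripleSum p               ≡⟨ cong (_+_ (lhs p)) (tripleSum≡H₁₂₁ N) ⟩
  lhs p + H₁₂₁ N                    ≡⟨ lhs+H₁₂₁ N ⟩
  H N * H₁₂ N + H₁₃ N + H₄ N        ≈⟨ +-cong (+-cong (≈0-*ʳ (H≈0 p∤2) H₁₂-integral) (H₁₃≈0 p∤2 H₄≈0′))
                                              H₄≈0′ ⟩
  0ℚ + 0ℚ + 0ℚ                      ≡⟨⟩
  0ℚ                                ∎))
  where
  open Localisation p-prime
  open Reflection p-prime
  open ≈-Reasoning
  p∤ : ∀ n .{{_ : ℕ.NonZero n}} → n < 7 → p ∤ n
  p∤ n n<7 = >⇒∤ (ℕP.<-≤-trans n<7 7≤p)
  p∤2 : p ∤ 2
  p∤2 = p∤ 2 (from-yes (2 ℕ.<? 7))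
  p∤15 : p ∤ 15
  p∤15 = p∤-* (p∤ 3 (from-yes (3 ℕ.<? 7))) (p∤ 5 (from-yes (5 ℕ.<? 7)))
  H₄≈0′ : H₄ N ≈ 0ℚ
  H₄≈0′ = let q , N≡q+q = N-even p∤2 in H₄≈0 p∤15 q N≡q+q
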